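{- Let $A$ be a commutative unital ring of prime characteristic $p$. If $(a_1,\ldots,a_n)$ is a $\lambda$-quiddity over $A$, then $(a_1^p,\ldots,a_n^p)$ is a $\lambda$-quiddity over $A$.
   Context: For a commutative unital ring $A$ and $a_1,\ldots,a_n\in A$, set $M_n(a_1,\ldots,a_n)=\begin{pmatrix}a_n&-1\\1&0\end{pmatrix}\cdots\begin{pmatrix}a_1&-1\\1&0\end{pmatrix}$. An $n$-tuple $(a_1,\ldots,a_n)\in A^n$ is a $\lambda$-quiddity over $A$ of size $n$ if $M_n(a_1,\ldots,a_n)=\pm Id$. -}

module Defs where

open import Level using (Level)
open import Data.Nat using (ℕ; zero; suc; _<_)
open import Data.Fin using (Fin; fromℕ; inject₁)
open import Data.Product using (_×_)
open import Relation.Nullary using (¬_)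
open import Algebra.Bundles using (CommutativeRing; Semiring)
import Algebra.Definitions.RawSemiring as RS

module _ {c ℓ : Level} (R : CommutativeRing c ℓ) where
  open CommutativeRing R
  open RS (Semiring.rawSemiring semiring) using () renaming (_×_ to _·_; _^_ to _^ᴿ_)

  pow : Carrier → ℕ → Carrier
  pow = _^ᴿ_

  record Mat2 : Set c where
    constructor mat
    field m11 m12 m21 m22 : Carrier

  _⊗_ : Mat2 → Mat2 → Mat2
  mat a b c' d ⊗ mat e f g h =
    mat (a * e + b * g) (a * f + b * h) (c' * e + d * g) (c' * f + d * h)

  IdM : Mat2
  IdM = mat 1# 0# 0# 1#

  _≈M_ : Mat2 → Mat2 → Set ℓ
  mat a b c' d ≈M mat e f g h = (a ≈ e) × (b ≈ f) × (c' ≈ g) × (d ≈ h)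

  negM : Mat2 → Mat2
  negM (mat a b c' d) = mat (- a) (- b) (- c') (- d)

  elemM : Carrier → Mat2
  elemM a = mat a (- 1#) 1# 0#

  -- M_n(a_1,...,a_n) = elemM a_n ⊗ ... ⊗ elemM a_1 ; the tuple is indexed by Fin n
  -- (index i : Fin n stands for a_{i+1})
  Mn : (n : ℕ) → (Fin n → Carrier) → Mat2
  Mn zero a = IdM
  Mn (suc n) a = elemM (a (fromℕ n)) ⊗ Mn n (λ i → a (inject₁ i))

  IsLambdaQuiddity : (n : ℕ) → (Fin n → Carrier) → Set ℓ
  IsLambdaQuiddity n a = (Mn n a ≈M IdM) ⊎' (Mn n a ≈M negM IdM)
    where open import Data.Sum using () renaming (_⊎_ to _⊎'_)

  HasCharacteristic : ℕ → Set ℓ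
  HasCharacteristic p = ((p · 1#) ≈ 0#) × (∀ m → 0 < m → m < p → ¬ ((m · 1#) ≈ 0#))

-- In characteristic p the Frobenius map x ↦ x ^ p is a ring endomorphism: the binomial
-- coefficients p C k with 0 < k < p are divisible by p, so (x + y) ^ p = x ^ p + y ^ p.
-- A ring homomorphism f maps M_n(a_1, …, a_n) entrywise to M_n(f a_1, …, f a_n) and fixes
-- ± Id, hence carries λ-quiddities to λ-quiddities.
module Submission where

open import Defs

open import Level using (Level)
open import Data.Nat using (ℕ; zero; suc; _<_; z<s; s<s; NonZero)
open import Data.Nat.Divisibility using (_∣_; divides)
open import Data.Nat.Primality using (Prime; ¬prime[0]; prime⇒nonZero)
open import Data.Fin using (Fin; toℕ; fromℕ; inject₁) renaming (zero to fzero; suc to fsuc)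
open import Data.Product using (_,_)
open import Data.Sum using (inj₁; inj₂)
open import Function using (_∘_)
open import Relation.Nullary using (contradiction)
import Relation.Binary.PropositionalEquality as ≡
open import Algebra.Bundles using (Semiring; CommutativeRing)
open import Algebra.Morphism.Structures using (IsRingHomomorphism)

module BinomialCoefficients where
  open import Data.Nat using (_+_; _*_)
  open import Data.Nat.Properties using (*-comm; *-zeroʳ; *-identityˡ; *-identityʳ; <⇒≱)
  open import Data.Nat.Combinatorics using (_C_; nC1≡n; nCk+nC[k+1]≡[n+1]C[k+1])
  open import Data.Nat.Divisibility using (∣⇒≤)
  open import Data.Nat.Primality using (euclidsLemma)
  open import Data.Nat.Tactic.RingSolver using (solve-∀)
  open import Relation.Binary.PropositionalEquality using (_≡_; refl; sym; trans; cong; cong₂; module ≡-Reasoning)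

  [1+k]*[1+n]C[1+k]≡[1+n]*nCk : ∀ n k → suc k * (suc n C suc k) ≡ suc n * (n C k)
  [1+k]*[1+n]C[1+k]≡[1+n]*nCk zero    zero    = refl
  [1+k]*[1+n]C[1+k]≡[1+n]*nCk zero    (suc k) = *-zeroʳ (suc (suc k))
  [1+k]*[1+n]C[1+k]≡[1+n]*nCk (suc n) zero    =
    trans (*-identityˡ _) (trans (nC1≡n (suc (suc n))) (sym (*-identityʳ _)))
  [1+k]*[1+n]C[1+k]≡[1+n]*nCk (suc n) (suc k) = begin
    suc (suc k) * (suc (suc n) C suc (suc k))
      ≡⟨ cong (suc (suc k) *_) (sym (nCk+nC[k+1]≡[n+1]C[k+1] (suc n) (suc k))) ⟩
    suc (suc k) * (A + B)
      ≡⟨ distribute k A B ⟩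
    A + suc k * A + suc (suc k) * B
      ≡⟨ cong₂ (λ u v → A + u + v) ([1+k]*[1+n]C[1+k]≡[1+n]*nCk n k)
                                   ([1+k]*[1+n]C[1+k]≡[1+n]*nCk n (suc k)) ⟩
    A + suc n * (n C k) + suc n * (n C suc k)
      ≡⟨ collect n A (n C k) (n C suc k) ⟩
    A + suc n * (n C k + n C suc k)
      ≡⟨ cong (λ u → A + suc n * u) (nCk+nC[k+1]≡[n+1]C[k+1] n k) ⟩
    suc (suc n) * A
      ∎
    where
    open ≡-Reasoning
    A = suc n C suc k
    B = suc n C suc (suc k)
    distribute : ∀ k a b → suc (suc k) * (a + b) ≡ a + suc k * a + suc (suc k) * b
    distribute = solve-∀
    collect : ∀ n a b c → a + suc n * b + suc n * c ≡ a + suc n * (b + c)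
    collect = solve-∀

  prime∣pCk : ∀ {p k} → Prime p → 0 < k → k < p → p ∣ p C k
  prime∣pCk {suc n} {suc k} prime-p _ k<p
    with euclidsLemma (suc k) (suc n C suc k) prime-p
           (divides (n C k) (trans ([1+k]*[1+n]C[1+k]≡[1+n]*nCk n k) (*-comm (suc n) (n C k))))
  ... | inj₁ p∣k   = contradiction (∣⇒≤ p∣k) (<⇒≱ k<p)
  ... | inj₂ p∣pCk = p∣pCk

open BinomialCoefficients using (prime∣pCk)

module _ {c ℓ} (S : Semiring c ℓ) where
  open Semiring S
  open import Algebra.Properties.Semiring.Mult S using (_×_; ×-congʳ; ×-homo-1; ×-assoc-*; ×1-homo-*)
  open import Algebra.Properties.Semiring.Exp S using (_^_)
  open import Algebra.Properties.Semiring.Sum S using (sum; sum-cong-≋; sum-replicate-zero; sum-init-last)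
  open import Algebra.Properties.Semiring.Binomial S using (binomialTerm; binomialExpansion)
  open import Data.Fin.Properties using (toℕ-fromℕ; inject₁ℕ<)
  open import Data.Nat.Combinatorics using (nCn≡1)
  open import Data.Nat.Properties using (n∸n≡0)
  open import Relation.Binary.Reasoning.Setoid setoid

  ×-vanishes-on-multiples : ∀ {m n} → m × 1# ≈ 0# → m ∣ n → ∀ x → n × x ≈ 0#
  ×-vanishes-on-multiples {m} {n} m×1#≈0# (divides q ≡.refl) x = begin
    n × x                      ≈⟨ ×-congʳ n (*-identityˡ x) ⟨
    n × (1# * x)               ≈⟨ ×-assoc-* n 1# x ⟨
    (n × 1#) * x               ≈⟨ *-congʳ (×1-homo-* q m) ⟩
    ((q × 1#) * (m × 1#)) * x  ≈⟨ *-congʳ (*-congˡ m×1#≈0#) ⟩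
    ((q × 1#) * 0#) * x        ≈⟨ *-congʳ (zeroʳ _) ⟩
    0# * x                     ≈⟨ zeroˡ x ⟩
    0#                         ∎

  binomialTerm-first : ∀ x y n → binomialTerm x y n fzero ≈ y ^ n
  binomialTerm-first x y n = trans (×-homo-1 _) (*-identityˡ _)

  binomialTerm-last : ∀ x y n → binomialTerm x y n (fromℕ n) ≈ x ^ n
  binomialTerm-last x y n rewrite toℕ-fromℕ n | nCn≡1 n | n∸n≡0 n =
    trans (×-homo-1 _) (*-identityʳ _)

  binomialExpansion-ends : ∀ n x y →
    (∀ k → 0 < toℕ k → toℕ k < suc n → binomialTerm x y (suc n) k ≈ 0#) →
    binomialExpansion x y (suc n) ≈ y ^ suc n + x ^ suc n
  binomialExpansion-ends n x y inner≈0# = begin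
    t fzero + sum (t ∘ fsuc)
      ≈⟨ +-congˡ (sum-init-last (t ∘ fsuc)) ⟩
    t fzero + (sum (t ∘ fsuc ∘ inject₁) + t (fromℕ (suc n)))
      ≈⟨ +-cong (binomialTerm-first x y (suc n))
                (+-cong inner-sum≈0# (binomialTerm-last x y (suc n))) ⟩
    y ^ suc n + (0# + x ^ suc n)
      ≈⟨ +-congˡ (+-identityˡ _) ⟩
    y ^ suc n + x ^ suc n
      ∎
    where
    t : Fin (suc (suc n)) → Carrier
    t = binomialTerm x y (suc n)
    inner-sum≈0# : sum (t ∘ fsuc ∘ inject₁) ≈ 0#
    inner-sum≈0# = trans
      (sum-cong-≋ (λ i → inner≈0# (fsuc (inject₁ i)) z<s (s<s (inject₁ℕ< i))))
      (sum-replicate-zero n)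

  binomialExpansion-prime : ∀ {p} → Prime p → p × 1# ≈ 0# → ∀ x y →
    binomialExpansion x y p ≈ y ^ p + x ^ p
  binomialExpansion-prime {zero}  prime-0 _ _ _ = contradiction prime-0 ¬prime[0]
  binomialExpansion-prime {suc n} prime-p p×1#≈0# x y = binomialExpansion-ends n x y
    (λ k 0<k k<p → ×-vanishes-on-multiples p×1#≈0# (prime∣pCk prime-p 0<k k<p) _)

module _ {c ℓ} (R : CommutativeRing c ℓ) where
  open CommutativeRing R
  open import Algebra.Properties.Semiring.Mult semiring using (_×_)
  open import Algebra.Properties.Semiring.Exp semiring using (_^_; ^-congˡ)
  open import Algebra.Properties.CommutativeSemiring.Exp commutativeSemiring using (^-distrib-*)
  open import Algebra.Properties.CommutativeSemiring.Binomial commutativeSemiring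
    using (binomialExpansion) renaming (theorem to binomialTheorem)
  open import Algebra.Properties.Group +-group using (inverseˡ-unique)
  open import Relation.Binary.Reasoning.Setoid setoid

  1#^n≈1# : ∀ n → 1# ^ n ≈ 1#
  1#^n≈1# zero    = refl
  1#^n≈1# (suc n) = trans (*-identityˡ _) (1#^n≈1# n)

  0#^n≈0# : ∀ n → .{{NonZero n}} → 0# ^ n ≈ 0#
  0#^n≈0# (suc n) = zeroˡ _

  module _ {p} (prime-p : Prime p) (p×1#≈0# : p × 1# ≈ 0#) where

    0#^p≈0# : 0# ^ p ≈ 0#
    0#^p≈0# = 0#^n≈0# p {{prime⇒nonZero prime-p}}

    ^p-distrib-+ : ∀ x y → (x + y) ^ p ≈ x ^ p + y ^ p
    ^p-distrib-+ x y = begin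
      (x + y) ^ p             ≈⟨ binomialTheorem p x y ⟩
      binomialExpansion x y p ≈⟨ binomialExpansion-prime semiring prime-p p×1#≈0# x y ⟩
      y ^ p + x ^ p           ≈⟨ +-comm _ _ ⟩
      x ^ p + y ^ p           ∎

    [-x]^p≈-[x^p] : ∀ x → (- x) ^ p ≈ - (x ^ p)
    [-x]^p≈-[x^p] x = inverseˡ-unique _ _ (begin
      (- x) ^ p + x ^ p  ≈⟨ ^p-distrib-+ (- x) x ⟨
      (- x + x) ^ p      ≈⟨ ^-congˡ p (-‿inverseˡ x) ⟩
      0# ^ p             ≈⟨ 0#^p≈0# ⟩
      0#                 ∎)

    frobenius-isRingHomomorphism : IsRingHomomorphism rawRing rawRing (_^ p)
    frobenius-isRingHomomorphism = record
      { isSemiringHomomorphism = record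
        { isNearSemiringHomomorphism = record
          { +-isMonoidHomomorphism = record
            { isMagmaHomomorphism = record
              { isRelHomomorphism = record { cong = ^-congˡ p }
              ; homo = ^p-distrib-+
              }
            ; ε-homo = 0#^p≈0#
            }
          ; *-homo = λ x y → ^-distrib-* x y p
          }
        ; 1#-homo = 1#^n≈1# p
        }
      ; -‿homo = [-x]^p≈-[x^p]
      }

module _ {c ℓ} (R : CommutativeRing c ℓ) where
  open CommutativeRing R

  ≈M-trans : ∀ {A B C} → _≈M_ R A B → _≈M_ R B C → _≈M_ R A C
  ≈M-trans {mat _ _ _ _} {mat _ _ _ _} {mat _ _ _ _} (a , b , c , d) (a′ , b′ , c′ , d′) =
    trans a a′ , trans b b′ , trans c c′ , trans d d′

  negM-cong : ∀ {A B} → _≈M_ R A B → _≈M_ R (negM R A) (negM R B)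
  negM-cong {mat _ _ _ _} {mat _ _ _ _} (a , b , c , d) =
    -‿cong a , -‿cong b , -‿cong c , -‿cong d

  ⊗-cong : ∀ {A A′ B B′} → _≈M_ R A A′ → _≈M_ R B B′ → _≈M_ R (_⊗_ R A B) (_⊗_ R A′ B′)
  ⊗-cong {mat _ _ _ _} {mat _ _ _ _} {mat _ _ _ _} {mat _ _ _ _} (a , b , c , d) (e , f , g , h) =
    +-cong (*-cong a e) (*-cong b g) , +-cong (*-cong a f) (*-cong b h) ,
    +-cong (*-cong c e) (*-cong d g) , +-cong (*-cong c f) (*-cong d h)

module _ {c₁ ℓ₁ c₂ ℓ₂} (R : CommutativeRing c₁ ℓ₁) (S : CommutativeRing c₂ ℓ₂)
         {f : CommutativeRing.Carrier R → CommutativeRing.Carrier S}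
         (f-isRingHomomorphism :
           IsRingHomomorphism (CommutativeRing.rawRing R) (CommutativeRing.rawRing S) f) where
  module R = CommutativeRing R
  open CommutativeRing S
  open IsRingHomomorphism f-isRingHomomorphism

  mapM : Mat2 R → Mat2 S
  mapM (mat a b c d) = mat (f a) (f b) (f c) (f d)

  mapM-cong : ∀ {A B} → _≈M_ R A B → _≈M_ S (mapM A) (mapM B)
  mapM-cong {mat _ _ _ _} {mat _ _ _ _} (a , b , c , d) =
    ⟦⟧-cong a , ⟦⟧-cong b , ⟦⟧-cong c , ⟦⟧-cong d

  ⊗-mapM : ∀ A B → _≈M_ S (_⊗_ S (mapM A) (mapM B)) (mapM (_⊗_ R A B))
  ⊗-mapM (mat a b c d) (mat e f′ g h) =
    *+*-homo a e b g , *+*-homo a f′ b h , *+*-homo c e d g , *+*-homo c f′ d h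
    where
    *+*-homo : ∀ x y z w → f x * f y + f z * f w ≈ f (x R.* y R.+ z R.* w)
    *+*-homo x y z w = sym (trans (+-homo _ _) (+-cong (*-homo x y) (*-homo z w)))

  elemM-mapM : ∀ a → _≈M_ S (elemM S (f a)) (mapM (elemM R a))
  elemM-mapM a = refl , sym (trans (-‿homo R.1#) (-‿cong 1#-homo)) , sym 1#-homo , sym 0#-homo

  Mn-mapM : ∀ n a → _≈M_ S (Mn S n (f ∘ a)) (mapM (Mn R n a))
  Mn-mapM zero    a = sym 1#-homo , sym 0#-homo , sym 0#-homo , sym 1#-homo
  Mn-mapM (suc n) a = ≈M-trans S (⊗-cong S (elemM-mapM _) (Mn-mapM n (a ∘ inject₁))) (⊗-mapM _ _)

  mapM-IdM : _≈M_ S (mapM (IdM R)) (IdM S)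
  mapM-IdM = 1#-homo , 0#-homo , 0#-homo , 1#-homo

  mapM-negM : ∀ A → _≈M_ S (mapM (negM R A)) (negM S (mapM A))
  mapM-negM (mat a b c d) = -‿homo a , -‿homo b , -‿homo c , -‿homo d

  IsLambdaQuiddity-map : ∀ n a → IsLambdaQuiddity R n a → IsLambdaQuiddity S n (f ∘ a)
  IsLambdaQuiddity-map n a (inj₁ Mn≈Id) = inj₁ (≈M-trans S (Mn-mapM n a)
    (≈M-trans S (mapM-cong Mn≈Id) mapM-IdM))
  IsLambdaQuiddity-map n a (inj₂ Mn≈-Id) = inj₂ (≈M-trans S (Mn-mapM n a)
    (≈M-trans S (mapM-cong Mn≈-Id) (≈M-trans S (mapM-negM (IdM R)) (negM-cong S mapM-IdM))))

mainTheorem7 : {c ℓ : Level} (R : CommutativeRing c ℓ) (p : ℕ) → Prime p → HasCharacteristic R p →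
    (n : ℕ) (a : Fin n → CommutativeRing.Carrier R) → IsLambdaQuiddity R n a →
    IsLambdaQuiddity R n (λ i → pow R (a i) p)
mainTheorem7 R p prime-p (p·1≈0 , _) =
  IsLambdaQuiddity-map R R (frobenius-isRingHomomorphism R prime-p p·1≈0)
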